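{- For any $\mathrm{SQCLP}(\mathcal{S},\mathcal{D},\mathcal{C})$-program $\mathcal{P}$, $\mathcal{T}_{\mathcal{P}}$ is a well defined mapping, i.e. for every qc-interpretation $\mathcal{I}$ one has that $\mathcal{T}_{\mathcal{P}}(\mathcal{I})$ is a qc-interpretation. Moreover, $\mathcal{T}_{\mathcal{P}}$ is monotonic and continuous, and its pre-fixpoints are exactly the models of $\mathcal{P}$: for every qc-interpretation $\mathcal{I}$, $\mathcal{I} \models_{\mathcal{S},\mathcal{D},\mathcal{C}} \mathcal{P} \iff \mathcal{T}_{\mathcal{P}}(\mathcal{I}) \subseteq \mathcal{I}$.
   Context: Let $\langle \mathcal{S},\mathcal{D},\mathcal{C}\rangle$ be an admissible triple. $\mathcal{C}$ is a constraint domain whose carrier is the set of ground terms (built from variables, basic values and data constructors), with primitive predicates interpreted as boolean functions; $\mathcal{C}$-constraints are built from primitive atoms and equations $t == s$ by conjunction and existential quantification; valuations are ground substitutions, and $\Pi \models_{\mathcal{C}} \pi$ means every valuation solving the constraint set $\Pi$ solves $\pi$. $\mathcal{D}=\langle D,\trianglelefteq,\mathbf{b},\mathbf{t},\circ\rangle$ is a qualification domain: a lattice w.r.t. $\trianglelefteq$ with bottom $\mathbf{b}$, top $\mathbf{t}$ and greatest lower bound $\sqcap$, plus an attenuation operation $\circ$ which is associative, commutative, monotonic, satisfies $d\circ\mathbf{t}=d$, $d\circ\mathbf{b}=\mathbf{b}$, $d\circ e\trianglelefteq e$ (with $\mathbf{b}\neq d\circ e$ when $d,e\neq\mathbf{b}$)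 and $d\circ(e_1\sqcap e_2)=(d\circ e_1)\sqcap(d\circ e_2)$; $\mathcal{D}$ is expressible in $\mathcal{C}$. $\mathcal{S}$ is a $D$-valued proximity relation (reflexive: $\mathcal{S}(x,x)=\mathbf{t}$; symmetric; not necessarily transitive) on variables, basic values, data constructors, defined and primitive predicate symbols, behaving as the identity on variables and nonbottom only between identical symbols, between basic values, or between data constructors (resp. defined predicates) of equal arity. $\mathcal{S}$ extends to terms: $\mathcal{S}(t,t)=\mathbf{t}$; $\mathcal{S}(X,t)=\mathcal{S}(t,X)=\mathbf{b}$ for a variable $X\neq t$; constructors of different arities give $\mathbf{b}$; $\mathcal{S}(c(t_1,\dots,t_n),c'(t'_1,\dots,t'_n))=\mathcal{S}(c,c')\sqcap\mathcal{S}(t_1,t'_1)\sqcap\dots\sqcap\mathcal{S}(t_n,t'_n)$. For $\lambda\in D\setminus\{\mathbf{b}\}$ and constraint set $\Pi$, $t\approx_{\lambda,\Pi}s$ iff there are terms $\hat t,\hat s$ with $\Pi\models_{\mathcal{C}} t==\hat t$, $\Pi\models_{\mathcal{C}} s==\hat s$ and $\mathcal{S}(\hat t,\hat s)\trianglerighteq\lambda$. A $\mathrm{SQCLP}(\mathcal{S},\mathcal{D},\mathcal{C})$-program $\mathcal{P}$ is a set of clauses $p(t_1,\dots,t_n)\leftarrow_{\alpha} B_1\#w_1,\dots,B_m\#w_m$ with $p$ a defined predicate, attenuation factor $\alpha\in D\setminus\{\mathbf{b}\}$, atoms $B_j$ and thresholds $w_j\in (D\setminus\{\mathbf{b}\})\cup\{?\}$;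 $e\trianglerighteq^? w$ means $e\trianglerighteq w$ if $w\neq ?$ and is true otherwise. A qc-atom is $(A\#d\Leftarrow\Pi)$ with $A$ an atom, $d\in D$, $\Pi$ a set of $\mathcal{C}$-constraints; it is defined, equational or primitive according to the form of $A$, and observable iff $d\neq\mathbf{b}$ and $\Pi$ is satisfiable. $(A\#d\Leftarrow\Pi)$ $(\mathcal{D},\mathcal{C})$-entails $(A'\#d'\Leftarrow\Pi')$ iff there is a substitution $\theta$ with $A'=A\theta$, $d'\trianglelefteq d$ and $\Pi'\models_{\mathcal{C}}\Pi\theta$. A qc-interpretation is a set of defined observable qc-atoms closed under $(\mathcal{D},\mathcal{C})$-entailment. An observable qc-atom $\varphi$ is valid in $\mathcal{I}$ ($\mathcal{I}\Vdash_{\mathcal{S},\mathcal{D},\mathcal{C}}\varphi$) iff: $\varphi$ is defined and $\varphi\in\mathcal{I}$; or $\varphi=((t==s)\#d\Leftarrow\Pi)$ and $t\approx_{d,\Pi}s$; or $\varphi=(\kappa\#d\Leftarrow\Pi)$ is primitive and $\Pi\models_{\mathcal{C}}\kappa$. An observable $\varphi=(p'(t'_1,\dots,t'_n)\#d\Leftarrow\Pi)$ is an immediate consequence of $\mathcal{I}$ via the clause $p(t_1,\dots,t_n)\leftarrow_{\alpha}B_1\#w_1,\dots,B_m\#w_m$ iff there are a substitution $\theta$ and $d_0,\dots,d_n,e_1,\dots,e_m\in D\setminus\{\mathbf{b}\}$ with $\mathcal{S}(p',p)=d_0$, $t'_i\approx_{d_i,\Pi}t_i\theta$ for $i=1..n$,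 $\mathcal{I}\Vdash_{\mathcal{S},\mathcal{D},\mathcal{C}}(B_j\theta\#e_j\Leftarrow\Pi)$ with $e_j\trianglerighteq^? w_j$ for $j=1..m$, and $d\trianglelefteq d_0\sqcap d_1\sqcap\dots\sqcap d_n\sqcap(\alpha\circ(e_1\sqcap\dots\sqcap e_m))$ (an empty greatest lower bound being $\mathbf{t}$). $\mathcal{I}$ is a model of $\mathcal{P}$ ($\mathcal{I}\models_{\mathcal{S},\mathcal{D},\mathcal{C}}\mathcal{P}$) iff every defined observable qc-atom that is an immediate consequence of $\mathcal{I}$ via some clause of $\mathcal{P}$ belongs to $\mathcal{I}$. The qc-interpretations form a complete lattice under set inclusion (bottom $\emptyset$, top the set of all defined observable qc-atoms, glb intersection, lub union). $\mathcal{T}_{\mathcal{P}}(\mathcal{I})$ is the set of all $\varphi$ which are immediate consequences of $\mathcal{I}$ via some clause of $\mathcal{P}$. -}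

module Defs where

open import Level using (Level; 0ℓ) renaming (suc to lsuc)
open import Data.Nat using (ℕ; _≟_)
open import Data.Fin using (Fin)
open import Data.Bool using (Bool; true)
open import Data.Empty using (⊥)
import Data.Empty.Polymorphic
import Data.Product
open import Data.Unit using (⊤)
open import Data.Maybe using (Maybe; just; nothing)
open import Data.Product using (Σ; Σ-syntax; ∃; _×_; _,_)
open import Data.Sum using (_⊎_)
open import Data.Vec using (Vec; []; _∷_; lookup)
open import Relation.Nullary using (¬_; yes; no)
open import Relation.Unary using (Pred; _⊆_; _≐_)
open import Relation.Binary.PropositionalEquality using (_≡_; refl; subst)
import Relation.Binary.Lattice.Structures as LS

record QualDomain : Set₁ where
  field
    D     : Set
    _⊴_   : D → D → Set
    _⊔_   : D → D → D
    _⊓_   : D → D → D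
    t     : D
    b     : D
    _∘_   : D → D → D
    isBoundedLattice : LS.IsBoundedLattice _≡_ _⊴_ _⊔_ _⊓_ t b
    ∘-assoc   : ∀ d e f → (d ∘ e) ∘ f ≡ d ∘ (e ∘ f)
    ∘-comm    : ∀ d e → d ∘ e ≡ e ∘ d
    ∘-mono    : ∀ {d d′ e e′} → d ⊴ d′ → e ⊴ e′ → (d ∘ e) ⊴ (d′ ∘ e′)
    ∘-identʳ  : ∀ d → d ∘ t ≡ d
    ∘-zeroʳ   : ∀ d → d ∘ b ≡ b
    ∘-⊴       : ∀ d e → (d ∘ e) ⊴ e
    ∘-nonbot  : ∀ d e → ¬ d ≡ b → ¬ e ≡ b → ¬ (d ∘ e) ≡ b
    ∘-distrib-⊓ : ∀ d e₁ e₂ → d ∘ (e₁ ⊓ e₂) ≡ (d ∘ e₁) ⊓ (d ∘ e₂)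

record Signature : Set₁ where
  field
    BV  : Set
    DC  : ℕ → Set
    DP  : ℕ → Set
    PP  : ℕ → Set

Var : Set
Var = ℕ

module Terms (Σs : Signature) where
  open Signature Σs

  data Term (V : Set) : Set where
    var  : V → Term V
    bval : BV → Term V
    con  : ∀ {n} → DC n → Vec (Term V) n → Term V

  -- ground terms (the carrier of the constraint domain C)
  GTerm : Set
  GTerm = Term ⊥

  mutual
    substT : ∀ {V W} → (V → Term W) → Term V → Term W
    substT σ (var x)    = σ x
    substT σ (bval u)   = bval u
    substT σ (con c ts) = con c (substTs σ ts)

    substTs : ∀ {V W n} → (V → Term W) → Vec (Term V) n → Vec (Term W) n
    substTs σ []       = []
    substTs σ (x ∷ xs) = substT σ x ∷ substTs σ xs

  rename : ∀ {V W} → (V → W) → Term V → Term W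
  rename f = substT (λ x → var (f x))

module Domain (Σs : Signature) (interp : ∀ {n} → Signature.PP Σs n → Vec (Terms.GTerm Σs) n → Bool) where
  open Signature Σs
  open Terms Σs public

  -- C-constraints: primitive atoms, equations, conjunction, existential
  -- quantification (bound variable = 'nothing' in the extended scope)
  data Constraint (V : Set) : Set where
    primC : ∀ {n} → PP n → Vec (Term V) n → Constraint V
    _==_  : Term V → Term V → Constraint V
    _∧_   : Constraint V → Constraint V → Constraint V
    exC   : Constraint (Maybe V) → Constraint V

  liftσ : ∀ {V W : Set} → (V → Term W) → Maybe V → Term (Maybe W)
  liftσ σ nothing  = var nothing
  liftσ σ (just x) = rename just (σ x)

  substC : ∀ {V W : Set} → (V → Term W) → Constraint V → Constraint W
  substC σ (primC r ts) = primC r (substTs σ ts)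
  substC σ (s == u)     = substT σ s == substT σ u
  substC σ (π ∧ π′)     = substC σ π ∧ substC σ π′
  substC σ (exC π)      = exC (substC (liftσ σ) π)

  extend : ∀ {V : Set} → (V → GTerm) → GTerm → Maybe V → GTerm
  extend η g nothing  = g
  extend η g (just x) = η x

  Solves : ∀ {V : Set} → (V → GTerm) → Constraint V → Set
  Solves η (primC r ts) = interp r (substTs η ts) ≡ true
  Solves η (s == u)     = substT η s ≡ substT η u
  Solves η (π ∧ π′)     = Solves η π × Solves η π′
  Solves η (exC π)      = Σ GTerm λ g → Solves (extend η g) π

  Valuation : Set
  Valuation = Var → GTerm

  CSet : Set₁
  CSet = Pred (Constraint Var) 0ℓ

  SolvesSet : Valuation → CSet → Set
  SolvesSet η Π = ∀ π → Π π → Solves η π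

  _⊨_ : CSet → Constraint Var → Set
  Π ⊨ π = ∀ η → SolvesSet η Π → Solves η π

  _⊨ˢ_ : CSet → CSet → Set
  Π ⊨ˢ Π′ = ∀ π → Π′ π → Π ⊨ π

  Satisfiable : CSet → Set
  Satisfiable Π = Σ Valuation λ η → SolvesSet η Π

  _[_]ˢ : CSet → (Var → Term Var) → CSet
  Π [ θ ]ˢ = λ π′ → Σ (Constraint Var) λ π → Π π × π′ ≡ substC θ π

-- Proximity relations (components on symbols; all other pairs of
-- distinct symbols are b, variables are related only to themselves,
-- primitive predicate symbols only to themselves).

record Proximity (Σs : Signature) (𝒟 : QualDomain) : Set where
  open Signature Σs
  open QualDomain 𝒟
  field
    S-BV : BV → BV → D
    S-DC : ∀ {n} → DC n → DC n → D
    S-DP : ∀ {n} → DP n → DP n → D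
    S-BV-refl : ∀ u → S-BV u u ≡ t
    S-BV-sym  : ∀ u u′ → S-BV u u′ ≡ S-BV u′ u
    S-DC-refl : ∀ {n} (c : DC n) → S-DC c c ≡ t
    S-DC-sym  : ∀ {n} (c c′ : DC n) → S-DC c c′ ≡ S-DC c′ c
    S-DP-refl : ∀ {n} (p : DP n) → S-DP p p ≡ t
    S-DP-sym  : ∀ {n} (p p′ : DP n) → S-DP p p′ ≡ S-DP p′ p

module SQCLP (Σs : Signature) (𝒟 : QualDomain) (𝒮 : Proximity Σs 𝒟)
             (interp : ∀ {n} → Signature.PP Σs n → Vec (Terms.GTerm Σs) n → Bool) where
  open Signature Σs
  open QualDomain 𝒟
  open Proximity 𝒮
  open Domain Σs interp public

  Tm : Set
  Tm = Term Var

  mutual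
    S-Tm : Tm → Tm → D
    S-Tm (var x) (var y) with x ≟ y
    ... | yes _ = t
    ... | no _  = b
    S-Tm (bval u) (bval u′) = S-BV u u′
    S-Tm (con {n} c ts) (con {m} c′ ts′) with n ≟ m
    ... | yes refl = S-DC c c′ ⊓ S-Tms ts ts′
    ... | no _     = b
    S-Tm _ _ = b

    S-Tms : ∀ {n} → Vec Tm n → Vec Tm n → D
    S-Tms []       []         = t
    S-Tms (x ∷ xs) (y ∷ ys)   = S-Tm x y ⊓ S-Tms xs ys

  S-Pred : ∀ {n m} → DP n → DP m → D
  S-Pred {n} {m} p p′ with n ≟ m
  ... | yes refl = S-DP p p′
  ... | no _     = b

  Approx : Tm → D → CSet → Tm → Set
  Approx s λ′ Π u = Σ Tm λ ŝ → Σ Tm λ û →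
    (Π ⊨ (s == ŝ)) × (Π ⊨ (u == û)) × (λ′ ⊴ S-Tm ŝ û)

  data Atom : Set where
    defA  : ∀ {n} → DP n → Vec Tm n → Atom
    primA : ∀ {n} → PP n → Vec Tm n → Atom
    _≈ₐ_  : Tm → Tm → Atom

  substA : (Var → Tm) → Atom → Atom
  substA θ (defA p ts)  = defA p (substTs θ ts)
  substA θ (primA r ts) = primA r (substTs θ ts)
  substA θ (s ≈ₐ u)      = substT θ s ≈ₐ substT θ u

  record QcAtom : Set₁ where
    constructor _#_⇐_
    field
      atom : Atom
      deg  : D
      ctx  : CSet

  IsDefined : QcAtom → Set
  IsDefined (defA _ _ # _ ⇐ _) = ⊤
  IsDefined (_ # _ ⇐ _)        = ⊥

  Observable : QcAtom → Set
  Observable (A # d ⇐ Π) = (¬ d ≡ b) × Satisfiable Π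

  Entails : QcAtom → QcAtom → Set
  Entails (A # d ⇐ Π) (A′ # d′ ⇐ Π′) =
    Σ (Var → Tm) λ θ → (A′ ≡ substA θ A) × (d′ ⊴ d) × (Π′ ⊨ˢ (Π [ θ ]ˢ))

  QcSet : Set₁
  QcSet = Pred QcAtom 0ℓ

  record IsQcInterpretation (I : QcSet) : Set₁ where
    field
      defined    : ∀ φ → I φ → IsDefined φ
      observable : ∀ φ → I φ → Observable φ
      closed     : ∀ φ ψ → I φ → Observable ψ → Entails φ ψ → I ψ

  QcInterpretation : Set₁
  QcInterpretation = Σ QcSet IsQcInterpretation

  Valid : QcSet → QcAtom → Set
  Valid I φ@(defA _ _ # _ ⇐ _)     = Observable φ × I φ
  Valid I φ@((s ≈ₐ u) # d ⇐ Π)     = Observable φ × Approx s d Π u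
  Valid I φ@(primA r ts # d ⇐ Π)  = Observable φ × (Π ⊨ primC r ts)

  data Threshold : Set where
    ？   : Threshold
    thr  : (w : D) → ¬ w ≡ b → Threshold

  _⊵?_ : D → Threshold → Set
  e ⊵? ？         = ⊤
  e ⊵? thr w _   = w ⊴ e

  record Clause : Set where
    field
      {arity} : ℕ
      hd      : DP arity
      args    : Vec Tm arity
      α       : D
      α≢b     : ¬ α ≡ b
      {len}   : ℕ
      body    : Vec (Atom × Threshold) len

  Program : Set₁
  Program = Pred Clause 0ℓ

  glb : ∀ {n} → Vec D n → D
  glb []       = t
  glb (x ∷ xs) = x ⊓ glb xs

  ImmCondition : QcSet → Clause → ∀ {n} → DP n → Vec Tm n → D → CSet → Set
  ImmCondition I C {n} p′ ts′ d Π =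
    Σ (Var → Tm) λ θ →
    Σ (arity ≡ n) λ eq →
    Σ D λ d₀ → Σ (Vec D arity) λ ds → Σ (Vec D len) λ es →
      (S-Pred p′ hd ≡ d₀) × (¬ d₀ ≡ b)
    × (∀ i → ¬ lookup ds i ≡ b)
    × (∀ i → Approx (lookup (subst (Vec Tm) (symm eq) ts′) i) (lookup ds i) Π
                    (substT θ (lookup args i)))
    × (∀ j → ¬ lookup es j ≡ b)
    × (∀ j → Valid I (substA θ (Data.Product.proj₁ (lookup body j)) # lookup es j ⇐ Π))
    × (∀ j → lookup es j ⊵? Data.Product.proj₂ (lookup body j))
    × (d ⊴ (d₀ ⊓ (glb ds ⊓ (α ∘ glb es))))
    where
      open Clause C
      symm : ∀ {A : Set} {x y : A} → x ≡ y → y ≡ x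
      symm refl = refl

  ImmConsequence : QcSet → Clause → QcAtom → Set
  ImmConsequence I C φ@(defA p′ ts′ # d ⇐ Π) = Observable φ × ImmCondition I C p′ ts′ d Π
  ImmConsequence I C (_ # _ ⇐ _) = ⊥

  IsModel : QcSet → Program → Set₁
  IsModel I P = ∀ C → P C → ∀ φ → IsDefined φ → Observable φ → ImmConsequence I C φ → I φ

  T : Program → QcSet → QcSet
  T P I φ = Σ Clause λ C → P C × ImmConsequence I C φ

  Monotonic : (QcSet → QcSet) → Set₁
  Monotonic F = ∀ (I J : QcInterpretation) →
    Data.Product.proj₁ I ⊆ Data.Product.proj₁ J →
    F (Data.Product.proj₁ I) ⊆ F (Data.Product.proj₁ J)

  ⋃ : {K : Set} → (K → QcSet) → QcSet
  ⋃ {K} F φ = Σ K λ k → F k φ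

  Directed : {K : Set} → (K → QcInterpretation) → Set₁
  Directed {K} 𝓘 = K × (∀ k k′ → Σ K λ k″ →
    (Data.Product.proj₁ (𝓘 k) ⊆ Data.Product.proj₁ (𝓘 k″)) ×
    (Data.Product.proj₁ (𝓘 k′) ⊆ Data.Product.proj₁ (𝓘 k″)))

  Continuous : (QcSet → QcSet) → Set₁
  Continuous F = ∀ {K : Set} (𝓘 : K → QcInterpretation) → Directed 𝓘 →
    F (⋃ (λ k → Data.Product.proj₁ (𝓘 k))) ≐ ⋃ (λ k → F (Data.Product.proj₁ (𝓘 k)))

-- Every ingredient of an immediate consequence (entailment between
-- constraint sets, the proximity of terms, the validity of body atoms) is
-- stable under instantiating the atom by a substitution θ and replacing
-- its constraint set by one entailing Π θ, and proximity on terms can only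
-- grow under substitution; so T_P(I) is again closed under entailment.
-- Validity is monotone in I, which gives monotonicity; a clause body is
-- finite, so in a directed union its defined body atoms already lie in a
-- single member, which gives continuity.
module Submission where

open import Defs
open import Data.Bool using (Bool; true)
open import Data.Vec using (Vec; []; _∷_; lookup)
open import Data.Fin using (Fin; zero; suc)
open import Data.Nat using (zero; suc; _≟_)
open import Data.Empty using (⊥-elim)
open import Data.Unit using (tt)
open import Data.Maybe using (Maybe; just; nothing)
open import Data.Product using (Σ; _×_; _,_; proj₁; proj₂)
open import Function.Bundles using (_⇔_; mk⇔; Equivalence)
open import Relation.Nullary using (¬_; yes; no)
open import Relation.Unary using (_⊆_)
open import Relation.Binary.PropositionalEquality
  using (_≡_; refl; sym; trans; cong; cong₂; subst; subst₂)
import Relation.Binary.Lattice.Structures as LS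
import Relation.Binary.Structures as RS

module Substitution (Σs : Signature) where
  open Terms Σs

  mutual
    substT-fusion : ∀ {U V W : Set} (σ : U → Term V) (ρ : V → Term W) (τ : U → Term W) →
      (∀ x → substT ρ (σ x) ≡ τ x) → ∀ s → substT ρ (substT σ s) ≡ substT τ s
    substT-fusion σ ρ τ e (var x)    = e x
    substT-fusion σ ρ τ e (bval u)   = refl
    substT-fusion σ ρ τ e (con c ts) = cong (con c) (substTs-fusion σ ρ τ e ts)

    substTs-fusion : ∀ {U V W : Set} {n} (σ : U → Term V) (ρ : V → Term W) (τ : U → Term W) →
      (∀ x → substT ρ (σ x) ≡ τ x) →
      ∀ (ts : Vec (Term U) n) → substTs ρ (substTs σ ts) ≡ substTs τ ts
    substTs-fusion σ ρ τ e []       = refl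
    substTs-fusion σ ρ τ e (s ∷ ts) = cong₂ _∷_ (substT-fusion σ ρ τ e s) (substTs-fusion σ ρ τ e ts)

  lookup-substTs : ∀ {V W : Set} {n} (σ : V → Term W) (ts : Vec (Term V) n) i →
    lookup (substTs σ ts) i ≡ substT σ (lookup ts i)
  lookup-substTs σ (x ∷ ts) zero    = refl
  lookup-substTs σ (x ∷ ts) (suc i) = lookup-substTs σ ts i

module Constraints (Σs : Signature)
    (interp : ∀ {n} → Signature.PP Σs n → Vec (Terms.GTerm Σs) n → Bool) where
  open Domain Σs interp
  open Substitution Σs

  substT-liftσ : ∀ {V W : Set} (σ : V → Term W) (η : W → GTerm) (η′ : V → GTerm) →
    (∀ x → substT η (σ x) ≡ η′ x) →
    ∀ g y → substT (extend η g) (liftσ σ y) ≡ extend η′ g y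
  substT-liftσ σ η η′ e g nothing  = refl
  substT-liftσ σ η η′ e g (just x) =
    trans (substT-fusion (λ y → var (just y)) (extend η g) η (λ _ → refl) (σ x)) (e x)

  Solves-substC : ∀ {V W : Set} (σ : V → Term W) (η : W → GTerm) (η′ : V → GTerm) →
    (∀ x → substT η (σ x) ≡ η′ x) → ∀ π → Solves η (substC σ π) ⇔ Solves η′ π
  Solves-substC σ η η′ e (primC r ts) =
    mk⇔ (subst (λ v → interp r v ≡ true) fused)
        (subst (λ v → interp r v ≡ true) (sym fused))
    where fused = substTs-fusion σ η η′ e ts
  Solves-substC σ η η′ e (s == u) =
    mk⇔ (λ h → trans (sym (fused s)) (trans h (fused u)))
        (λ h → trans (fused s) (trans h (sym (fused u))))
    where fused = substT-fusion σ η η′ e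
  Solves-substC σ η η′ e (π ∧ π′) =
    mk⇔ (λ (h , h′) → to ih h , to ih′ h′) (λ (h , h′) → from ih h , from ih′ h′)
    where
      open Equivalence
      ih  = Solves-substC σ η η′ e π
      ih′ = Solves-substC σ η η′ e π′
  Solves-substC σ η η′ e (exC π) =
    mk⇔ (λ (g , h) → g , to (ih g) h) (λ (g , h) → g , from (ih g) h)
    where
      open Equivalence
      ih = λ g → Solves-substC (liftσ σ) (extend η g) (extend η′ g) (substT-liftσ σ η η′ e g) π

  ⊨-instantiate : ∀ {Π Π′ : CSet} (θ : Var → Term Var) → Π′ ⊨ˢ (Π [ θ ]ˢ) →
    ∀ π → Π ⊨ π → Π′ ⊨ substC θ π
  ⊨-instantiate {Π} θ Π′⊨Πθ π Π⊨π η η⊨Π′ = from (solves π) (Π⊨π (η ⊙θ) ηθ⊨Π)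
    where
      open Equivalence
      _⊙θ : Valuation → Valuation
      (η ⊙θ) x = substT η (θ x)
      solves = Solves-substC θ η (η ⊙θ) (λ _ → refl)
      ηθ⊨Π : SolvesSet (η ⊙θ) Π
      ηθ⊨Π π₀ π₀∈Π = to (solves π₀) (Π′⊨Πθ (substC θ π₀) (π₀ , π₀∈Π , refl) η η⊨Π′)

module Fixpoint (Σs : Signature) (𝒟 : QualDomain) (𝒮 : Proximity Σs 𝒟)
    (interp : ∀ {n} → Signature.PP Σs n → Vec (Terms.GTerm Σs) n → Bool) where
  open QualDomain 𝒟
  open Proximity 𝒮
  open SQCLP Σs 𝒟 𝒮 interp
  open Substitution Σs
  open Constraints Σs interp
  open LS.IsBoundedLattice isBoundedLattice
    using (isPartialOrder; x∧y≤x; x∧y≤y; ∧-greatest; maximum; minimum)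
  open RS.IsPartialOrder isPartialOrder
    using () renaming (refl to ⊴-refl; trans to ⊴-trans; reflexive to ⊴-reflexive)

  mutual
    S-Tm-refl : ∀ u → t ⊴ S-Tm u u
    S-Tm-refl (var x) with x ≟ x
    ... | yes _ = ⊴-refl
    ... | no x≢x = ⊥-elim (x≢x refl)
    S-Tm-refl (bval u) = ⊴-reflexive (sym (S-BV-refl u))
    S-Tm-refl (con {n} c ts) with n ≟ n
    ... | yes refl = ∧-greatest (⊴-reflexive (sym (S-DC-refl c))) (S-Tms-refl ts)
    ... | no n≢n = ⊥-elim (n≢n refl)

    S-Tms-refl : ∀ {n} (ts : Vec Tm n) → t ⊴ S-Tms ts ts
    S-Tms-refl []       = ⊴-refl
    S-Tms-refl (x ∷ ts) = ∧-greatest (S-Tm-refl x) (S-Tms-refl ts)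

  mutual
    S-Tm-substT : ∀ (θ : Var → Tm) s u → S-Tm s u ⊴ S-Tm (substT θ s) (substT θ u)
    S-Tm-substT θ (var x) (var y) with x ≟ y
    ... | yes refl = ⊴-trans (maximum _) (S-Tm-refl (θ x))
    ... | no _     = minimum _
    S-Tm-substT θ (var _) (bval _)     = minimum _
    S-Tm-substT θ (var _) (con _ _)    = minimum _
    S-Tm-substT θ (bval _) (var _)     = minimum _
    S-Tm-substT θ (bval _) (bval _)    = ⊴-refl
    S-Tm-substT θ (bval _) (con _ _)   = minimum _
    S-Tm-substT θ (con _ _) (var _)    = minimum _
    S-Tm-substT θ (con _ _) (bval _)   = minimum _
    S-Tm-substT θ (con {n} c ts) (con {m} c′ ts′) with n ≟ m
    ... | yes refl = ∧-greatest (x∧y≤x _ _) (⊴-trans (x∧y≤y _ _) (S-Tms-substTs θ ts ts′))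
    ... | no _     = minimum _

    S-Tms-substTs : ∀ (θ : Var → Tm) {n} (ts ts′ : Vec Tm n) →
      S-Tms ts ts′ ⊴ S-Tms (substTs θ ts) (substTs θ ts′)
    S-Tms-substTs θ []       []         = ⊴-refl
    S-Tms-substTs θ (x ∷ ts) (y ∷ ts′) =
      ∧-greatest (⊴-trans (x∧y≤x _ _) (S-Tm-substT θ x y))
                 (⊴-trans (x∧y≤y _ _) (S-Tms-substTs θ ts ts′))

  Approx-instantiate : ∀ {Π Π′ : CSet} (θ : Var → Tm) → Π′ ⊨ˢ (Π [ θ ]ˢ) →
    ∀ s {e} u → Approx s e Π u → Approx (substT θ s) e Π′ (substT θ u)
  Approx-instantiate θ Π′⊨Πθ s u (ŝ , û , s≡ŝ , u≡û , e⊴Sŝû) =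
    substT θ ŝ , substT θ û ,
    ⊨-instantiate θ Π′⊨Πθ (s == ŝ) s≡ŝ , ⊨-instantiate θ Π′⊨Πθ (u == û) u≡û ,
    ⊴-trans e⊴Sŝû (S-Tm-substT θ ŝ û)

  substA-fusion : ∀ (θ θ′ : Var → Tm) A →
    substA θ′ (substA θ A) ≡ substA (λ x → substT θ′ (θ x)) A
  substA-fusion θ θ′ (defA p ts)  = cong (defA p) (substTs-fusion θ θ′ _ (λ _ → refl) ts)
  substA-fusion θ θ′ (primA r ts) = cong (primA r) (substTs-fusion θ θ′ _ (λ _ → refl) ts)
  substA-fusion θ θ′ (s ≈ₐ u)     =
    cong₂ _≈ₐ_ (substT-fusion θ θ′ _ (λ _ → refl) s) (substT-fusion θ θ′ _ (λ _ → refl) u)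

  Valid-mono : ∀ {I J : QcSet} → I ⊆ J → ∀ φ → Valid I φ → Valid J φ
  Valid-mono I⊆J (defA _ _ # _ ⇐ _)  (obs , φ∈I) = obs , I⊆J φ∈I
  Valid-mono I⊆J (primA _ _ # _ ⇐ _) valid       = valid
  Valid-mono I⊆J ((_ ≈ₐ _) # _ ⇐ _)  valid       = valid

  Valid-instantiate : (I : QcInterpretation) → ∀ {Π Π′ : CSet} (θ : Var → Tm) →
    Π′ ⊨ˢ (Π [ θ ]ˢ) → Satisfiable Π′ → ∀ A {e} → ¬ e ≡ b →
    Valid (proj₁ I) (A # e ⇐ Π) → Valid (proj₁ I) (substA θ A # e ⇐ Π′)
  Valid-instantiate I θ Π′⊨Πθ sat (defA q us) e≢b (_ , φ∈I) =
    (e≢b , sat) , IsQcInterpretation.closed (proj₂ I) _ _ φ∈I (e≢b , sat) (θ , refl , ⊴-refl , Π′⊨Πθ)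
  Valid-instantiate I θ Π′⊨Πθ sat (primA r us) e≢b (_ , Π⊨r) =
    (e≢b , sat) , ⊨-instantiate θ Π′⊨Πθ (primC r us) Π⊨r
  Valid-instantiate I θ Π′⊨Πθ sat (s ≈ₐ u) e≢b (_ , s≈u) =
    (e≢b , sat) , Approx-instantiate θ Π′⊨Πθ s u s≈u

  ImmConsequence-observable : ∀ {I C} φ → ImmConsequence I C φ → Observable φ
  ImmConsequence-observable (defA _ _ # _ ⇐ _) (obs , _) = obs

  ImmConsequence-defined : ∀ {I C} φ → ImmConsequence I C φ → IsDefined φ
  ImmConsequence-defined (defA _ _ # _ ⇐ _) _ = tt

  ImmConsequence-mono : ∀ {I J : QcSet} {C} → I ⊆ J → ∀ φ → ImmConsequence I C φ → ImmConsequence J C φ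
  ImmConsequence-mono I⊆J (defA _ _ # _ ⇐ _)
    (obs , θ , eq , d₀ , ds , es , Sp , d₀≢b , ds≢b , args≈ , es≢b , body⊩ , es⊵w , d⊴)
    = obs , θ , eq , d₀ , ds , es , Sp , d₀≢b , ds≢b , args≈ , es≢b ,
      (λ j → Valid-mono I⊆J _ (body⊩ j)) , es⊵w , d⊴

  T-mono : ∀ (P : Program) {I J : QcSet} → I ⊆ J → T P I ⊆ T P J
  T-mono P I⊆J {φ} (C , C∈P , imm) = C , C∈P , ImmConsequence-mono I⊆J φ imm

  -- An entailed ψ is an immediate consequence via the same clause, with the
  -- matching substitution θ′ composed after θ.
  T-closed : ∀ P (I : QcInterpretation) φ ψ →
    T P (proj₁ I) φ → Observable ψ → Entails φ ψ → T P (proj₁ I) ψ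
  T-closed P I (defA p ts # d ⇐ Π) (_ # d′ ⇐ Π′)
    (C , C∈P , _ , θ , refl , d₀ , ds , es , Sp , d₀≢b , ds≢b , args≈ , es≢b , body⊩ , es⊵w , d⊴)
    obsψ (θ′ , refl , d′⊴d , Π′⊨Πθ′) =
    C , C∈P , obsψ , θ″ , refl , d₀ , ds , es , Sp , d₀≢b , ds≢b ,
    (λ i → subst₂ (λ s u → Approx s _ Π′ u)
             (sym (lookup-substTs θ′ ts i))
             (substT-fusion θ θ′ θ″ (λ _ → refl) (lookup args i))
             (Approx-instantiate θ′ Π′⊨Πθ′ (lookup ts i) (substT θ (lookup args i)) (args≈ i))) ,
    es≢b ,
    (λ j → subst (λ A → Valid (proj₁ I) (A # lookup es j ⇐ Π′))
             (substA-fusion θ θ′ (proj₁ (lookup body j)))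
             (Valid-instantiate I θ′ Π′⊨Πθ′ (proj₂ obsψ) _ (es≢b j) (body⊩ j))) ,
    es⊵w , ⊴-trans d′⊴d d⊴
    where
      open Clause C
      θ″ : Var → Tm
      θ″ x = substT θ′ (θ x)

  T-isQcInterpretation : ∀ P (I : QcInterpretation) → IsQcInterpretation (T P (proj₁ I))
  T-isQcInterpretation P I = record
    { defined    = λ φ (_ , _ , imm) → ImmConsequence-defined φ imm
    ; observable = λ φ (_ , _ , imm) → ImmConsequence-observable φ imm
    ; closed     = T-closed P I
    }

  module _ {K : Set} (𝓘 : K → QcInterpretation) (directed : Directed 𝓘) where
    private
      ∣_∣ : K → QcSet
      ∣ k ∣ = proj₁ (𝓘 k)

    Valid-⋃ : ∀ φ → Valid (⋃ ∣_∣) φ → Σ K λ k → Valid ∣ k ∣ φ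
    Valid-⋃ (defA _ _ # _ ⇐ _)  (obs , k , φ∈Ik) = k , obs , φ∈Ik
    Valid-⋃ (primA _ _ # _ ⇐ _) valid = proj₁ directed , valid
    Valid-⋃ ((_ ≈ₐ _) # _ ⇐ _)  valid = proj₁ directed , valid

    directed-upperBound : ∀ {n} (f : Fin n → K) → Σ K λ k → ∀ j → ∣ f j ∣ ⊆ ∣ k ∣
    directed-upperBound {zero}  f = proj₁ directed , λ ()
    directed-upperBound {suc n} f with directed-upperBound (λ j → f (suc j))
    ... | k , fs⊆k with proj₂ directed (f zero) k
    ... | k′ , f0⊆k′ , k⊆k′ = k′ , λ { zero → f0⊆k′ ; (suc j) → λ φ∈ → k⊆k′ (fs⊆k j φ∈) }

    ImmConsequence-⋃ : ∀ {C} φ → ImmConsequence (⋃ ∣_∣) C φ → Σ K λ k → ImmConsequence ∣ k ∣ C φ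
    ImmConsequence-⋃ (defA _ _ # _ ⇐ _)
      (obs , θ , eq , d₀ , ds , es , Sp , d₀≢b , ds≢b , args≈ , es≢b , body⊩ , es⊵w , d⊴)
      = k , obs , θ , eq , d₀ , ds , es , Sp , d₀≢b , ds≢b , args≈ , es≢b ,
        (λ j → Valid-mono (witness⊆k j) _ (proj₂ (witness j))) , es⊵w , d⊴
      where
        witness = λ j → Valid-⋃ _ (body⊩ j)
        bound = directed-upperBound (λ j → proj₁ (witness j))
        k = proj₁ bound
        witness⊆k = proj₂ bound

    T-⋃⊆⋃-T : ∀ P → T P (⋃ ∣_∣) ⊆ ⋃ (λ k → T P ∣ k ∣)
    T-⋃⊆⋃-T P {φ} (C , C∈P , imm) with ImmConsequence-⋃ φ imm
    ... | k , immₖ = k , C , C∈P , immₖ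

    ⋃-T⊆T-⋃ : ∀ P → ⋃ (λ k → T P ∣ k ∣) ⊆ T P (⋃ ∣_∣)
    ⋃-T⊆T-⋃ P (k , φ∈TIk) = T-mono P (λ φ∈Ik → k , φ∈Ik) φ∈TIk

  model⇒prefixpoint : ∀ P (I : QcSet) → IsModel I P → T P I ⊆ I
  model⇒prefixpoint P I model {φ} (C , C∈P , imm) =
    model C C∈P φ (ImmConsequence-defined φ imm) (ImmConsequence-observable φ imm) imm

  prefixpoint⇒model : ∀ P (I : QcSet) → T P I ⊆ I → IsModel I P
  prefixpoint⇒model P I TI⊆I C C∈P φ _ _ imm = TI⊆I (C , C∈P , imm)

proposition1 : (Σs : Signature) (𝒟 : QualDomain) (𝒮 : Proximity Σs 𝒟)
    (interp : ∀ {n} → Signature.PP Σs n → Vec (Terms.GTerm Σs) n → Bool) →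
    let open SQCLP Σs 𝒟 𝒮 interp in
    (P : Program) →
      ((I : QcInterpretation) → IsQcInterpretation (T P (proj₁ I)))
    × Monotonic (T P)
    × Continuous (T P)
    × ((I : QcInterpretation) →
         (IsModel (proj₁ I) P → T P (proj₁ I) ⊆ proj₁ I)
       × (T P (proj₁ I) ⊆ proj₁ I → IsModel (proj₁ I) P))
proposition1 Σs 𝒟 𝒮 interp P =
  T-isQcInterpretation P ,
  (λ _ _ → T-mono P) ,
  (λ 𝓘 directed → T-⋃⊆⋃-T 𝓘 directed P , ⋃-T⊆T-⋃ 𝓘 directed P) ,
  (λ I → model⇒prefixpoint P (proj₁ I) , prefixpoint⇒model P (proj₁ I))
  where open Fixpoint Σs 𝒟 𝒮 interp
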